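{- Let $A$ be the adjacency matrix of a simple graph. Then over $\mathbb{F}_2$, $\chi(A+J;x)=\chi(A;x)+\chi'(A;x)$, where $\chi'$ denotes the formal derivative with respect to $x$.
   Context: $J$ is the all-ones matrix and $\chi(M;x)=\det(xI-M)$. -}

module Defs where

open import Level using (0ℓ)
open import Data.Bool using (Bool; true; false; _xor_; _∧_; if_then_else_)
open import Data.Nat using (ℕ; zero; suc)
open import Data.List using (List; []; _∷_)
open import Data.Fin using (Fin; zero; suc; toℕ; punchIn; _≟_)
open import Relation.Nullary.Decidable using (⌊_⌋)
open import Relation.Binary.PropositionalEquality using (_≡_)
open import Algebra.Bundles.Raw using (RawRing)
open import Data.Product using (_×_)

-- The field F₂ is Bool with _xor_ as addition and _∧_ as multiplication.

F₂ : Set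
F₂ = Bool

even : ℕ → Bool
even zero = true
even (suc n) = if even n then false else true

-- Polynomials over F₂: coefficient lists, lowest degree first.
-- Equality of polynomials is coefficientwise (`_≈ₚ_`), so trailing
-- zeros are irrelevant.

Poly : Set
Poly = List F₂

coeff : Poly → ℕ → F₂
coeff []       _       = false
coeff (a ∷ p)  zero    = a
coeff (a ∷ p)  (suc k) = coeff p k

_≈ₚ_ : Poly → Poly → Set
p ≈ₚ q = ∀ k → coeff p k ≡ coeff q k

infixl 6 _+ₚ_
_+ₚ_ : Poly → Poly → Poly
[]      +ₚ q       = q
(a ∷ p) +ₚ []      = a ∷ p
(a ∷ p) +ₚ (b ∷ q) = (a xor b) ∷ (p +ₚ q)

-- additive inverse (over F₂, -a = a)
-ₚ_ : Poly → Poly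
-ₚ p = p

scaleₚ : F₂ → Poly → Poly
scaleₚ c []      = []
scaleₚ c (a ∷ p) = (c ∧ a) ∷ scaleₚ c p

infixl 7 _*ₚ_
_*ₚ_ : Poly → Poly → Poly
[]      *ₚ q = []
(a ∷ p) *ₚ q = scaleₚ a q +ₚ (false ∷ (p *ₚ q))

constₚ : F₂ → Poly
constₚ c = c ∷ []

0ₚ 1ₚ Xₚ : Poly
0ₚ = []
1ₚ = true ∷ []
Xₚ = false ∷ true ∷ []

-- n · a in F₂ (n-fold sum of a)
natMul : ℕ → F₂ → F₂
natMul n a = if even n then false else a

-- Formal derivative: d/dx Σ aₖ xᵏ = Σ k·aₖ x^(k-1).
derivFrom : ℕ → Poly → Poly
derivFrom k []      = []
derivFrom k (a ∷ p) = natMul k a ∷ derivFrom (suc k) p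

deriv : Poly → Poly
deriv []      = []
deriv (a ∷ p) = derivFrom 1 p

F₂[x] : RawRing 0ℓ 0ℓ
F₂[x] = record
  { Carrier = Poly ; _≈_ = _≈ₚ_ ; _+_ = _+ₚ_ ; _*_ = _*ₚ_
  ; -_ = -ₚ_ ; 0# = 0ₚ ; 1# = 1ₚ }

module Det (R : RawRing 0ℓ 0ℓ) where
  open RawRing R

  sumFin : ∀ {n} → (Fin n → Carrier) → Carrier
  sumFin {zero}  f = 0#
  sumFin {suc n} f = f zero + sumFin (λ j → f (suc j))

  sign : ∀ {n} → Fin n → Carrier
  sign j = if even (toℕ j) then 1# else - 1#

  det : ∀ n → (Fin n → Fin n → Carrier) → Carrier
  det zero    M = 1#
  det (suc n) M =
    sumFin (λ j → sign j * M zero j * det n (λ i k → M (suc i) (punchIn j k)))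

Mat : ℕ → Set
Mat n = Fin n → Fin n → F₂

δ : ∀ {n} → Fin n → Fin n → F₂
δ i j = ⌊ i ≟ j ⌋

χ : ∀ {n} → Mat n → Poly
χ {n} M = Det.det F₂[x] n (λ i j → scaleₚ (δ i j) Xₚ +ₚ (-ₚ constₚ (M i j)))

J : ∀ {n} → Mat n
J i j = true

_+ₘ_ : ∀ {n} → Mat n → Mat n → Mat n
(M +ₘ N) i j = M i j xor N i j

IsSimpleGraphAdj : ∀ {n} → Mat n → Set
IsSimpleGraphAdj A = (∀ i j → A i j ≡ A j i) × (∀ i → A i i ≡ false)

-- Put N = xI + A over F₂[x], so that χ(A + J) = det(N + J). In characteristic two
-- determinants carry no signs, and expanding along the rows gives
-- det(N + J) = det N + Σ_{a,b} det N_{ab}, where N_{ab} deletes row a and column b: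
-- the terms in which J occupies two rows cancel in pairs. As A is symmetric, N_{ab}
-- is the transpose of N_{ba}, so the off-diagonal minors cancel in pairs as well and
-- Σ_{a,b} det N_{ab} = Σ_a det N_{aa}. Since dN/dx = I, Jacobi's formula for the
-- derivation d/dx identifies this sum with (det N)′. All expansions are along the
-- first row; comparing them amounts to summing over ordered pairs of distinct
-- columns, a sum invariant under swapping the pair.

module Submission where

open import Defs
open import Level using (0ℓ)
open import Algebra.Bundles using (CommutativeMonoid; CommutativeRing)
open import Data.Bool using (true; false; _xor_; _∧_; if_then_else_)
open import Data.Bool.Properties
  using ( xor-assoc; xor-comm; xor-identityʳ; xor-same
        ; ∧-assoc; ∧-comm; ∧-zeroʳ; ∧-distribˡ-xor; ∧-distribʳ-xor )
open import Data.Empty using (⊥-elim)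
open import Data.Fin using (Fin; zero; suc; toℕ; punchIn; lift)
open import Data.Fin.Properties using (_≟_)
open import Data.List using ([]; _∷_)
open import Data.Nat using (ℕ; zero; suc)
open import Data.Product using (_,_)
open import Function using (_∘_)
open import Relation.Binary.Bundles using (Setoid)
open import Relation.Binary.PropositionalEquality as ≡ using (_≡_; _≗_)
open import Relation.Nullary using (yes; no)
open import Relation.Nullary.Decidable using (⌊⌋-map′)

δ-suc : ∀ {n} (i j : Fin n) → δ (suc i) (suc j) ≡ δ i j
δ-suc i j = ⌊⌋-map′ _ _ (i ≟ j)

δ-sym : ∀ {n} (i j : Fin n) → δ i j ≡ δ j i
δ-sym i j with i ≟ j | j ≟ i
... | yes _   | yes _   = ≡.refl
... | yes i≡j | no  j≢i = ⊥-elim (j≢i (≡.sym i≡j))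
... | no  i≢j | yes j≡i = ⊥-elim (i≢j (≡.sym j≡i))
... | no  _   | no  _   = ≡.refl

module PairSums {c ℓ} (M : CommutativeMonoid c ℓ) where

  open CommutativeMonoid M
    renaming (_∙_ to _+_; ε to 0#; ∙-cong to +-cong; ∙-congˡ to +-congˡ; ∙-congʳ to +-congʳ)
  open import Algebra.Properties.CommutativeMonoid.Sum M
  open import Algebra.Properties.CommutativeSemigroup commutativeSemigroup using (x∙yz≈y∙xz)
  open import Relation.Binary.Reasoning.Setoid setoid

  PairFunction : ℕ → Set c
  PairFunction m = Fin (suc (suc m)) → Fin (suc (suc m)) → (Fin m → Fin (suc (suc m))) → Carrier

  Extensional : ∀ {m} → PairFunction m → Set ℓ
  Extensional f = ∀ x y {g h} → g ≗ h → f x y g ≈ f x y h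

  -- `punchIn x ∘ punchIn y` lists, in increasing order, the indices other than x and punchIn x y.
  ∑≢ : ∀ {m} → PairFunction m → Carrier
  ∑≢ {m} f = ∑[ x < suc (suc m) ] ∑[ y < suc m ] f x (punchIn x y) (punchIn x ∘ punchIn y)

  shift : ∀ {m} → PairFunction (suc m) → PairFunction m
  shift f x y g = f (suc x) (suc y) (lift 1 g)

  shift-extensional : ∀ {m} {f : PairFunction (suc m)} → Extensional f → Extensional (shift f)
  shift-extensional ext x y g≗h = ext (suc x) (suc y) λ { zero → ≡.refl ; (suc b) → ≡.cong suc (g≗h b) }

  ∑≢-two : (f : PairFunction 0) → Extensional f →
           ∑≢ f ≈ f zero (suc zero) (punchIn zero ∘ punchIn zero)
                  + f (suc zero) zero (punchIn zero ∘ punchIn zero)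
  ∑≢-two f ext = begin
    (f zero (suc zero) _ + 0#) + ((f (suc zero) zero _ + 0#) + 0#)
      ≈⟨ +-cong (identityʳ _) (trans (identityʳ _) (identityʳ _)) ⟩
    f zero (suc zero) _ + f (suc zero) zero _
      ≈⟨ +-congˡ (ext (suc zero) zero (λ ())) ⟩
    f zero (suc zero) _ + f (suc zero) zero _ ∎

  ∑≢-suc : ∀ {m} (f : PairFunction (suc m)) → Extensional f →
           ∑≢ f ≈ ∑[ y < suc (suc m) ] f zero (suc y) (suc ∘ punchIn y)
                  + (∑[ x < suc (suc m) ] f (suc x) zero (suc ∘ punchIn x) + ∑≢ (shift f))
  ∑≢-suc {m} f ext = +-congˡ (trans (sum-cong-≋ row≈) (∑-distrib-+ B (row (shift f))))
    where
    B : Fin (suc (suc m)) → Carrier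
    B x = f (suc x) zero (suc ∘ punchIn x)
    row : PairFunction m → Fin (suc (suc m)) → Carrier
    row h x = ∑[ y < suc m ] h x (punchIn x y) (punchIn x ∘ punchIn y)
    entry≈ : ∀ x y → f (suc x) (suc (punchIn x y)) (punchIn (suc x) ∘ punchIn (suc y))
                   ≈ shift f x (punchIn x y) (punchIn x ∘ punchIn y)
    entry≈ x y = ext (suc x) (suc (punchIn x y)) λ { zero → ≡.refl ; (suc b) → ≡.refl }
    row≈ : ∀ x → B x + ∑[ y < suc m ] f (suc x) (suc (punchIn x y)) (punchIn (suc x) ∘ punchIn (suc y))
               ≈ B x + row (shift f) x
    row≈ x = +-congˡ (sum-cong-≋ (entry≈ x))

  ∑≢-swap : ∀ {m} (f : PairFunction m) → Extensional f → ∑≢ f ≈ ∑≢ (λ x y → f y x)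
  ∑≢-swap {zero} f ext = trans (∑≢-two f ext) (trans (comm _ _) (sym (∑≢-two _ λ x y → ext y x)))
  ∑≢-swap {suc m} f ext = begin
    ∑≢ f                               ≈⟨ ∑≢-suc f ext ⟩
    A + (B + ∑≢ (shift f))             ≈⟨ x∙yz≈y∙xz A B _ ⟩
    B + (A + ∑≢ (shift f))             ≈⟨ +-congˡ (+-congˡ (∑≢-swap (shift f) (shift-extensional ext))) ⟩
    B + (A + ∑≢ (λ x y → shift f y x)) ≈⟨ ∑≢-suc (λ x y → f y x) (λ x y → ext y x) ⟨
    ∑≢ (λ x y → f y x)                 ∎
    where
    A B : Carrier
    A = ∑[ y < suc (suc m) ] f zero (suc y) (suc ∘ punchIn y)
    B = ∑[ x < suc (suc m) ] f (suc x) zero (suc ∘ punchIn x)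

  -- Each unordered pair is counted twice.
  ∑≢-symmetric : (∀ z → z + z ≈ 0#) → ∀ {m} (f : PairFunction m) → Extensional f →
                 (∀ x y g → f x y g ≈ f y x g) → ∑≢ f ≈ 0#
  ∑≢-symmetric z+z≈0 {zero} f ext f-sym =
    trans (∑≢-two f ext) (trans (+-congˡ (f-sym _ _ _)) (z+z≈0 _))
  ∑≢-symmetric z+z≈0 {suc m} f ext f-sym = begin
    ∑≢ f                   ≈⟨ ∑≢-suc f ext ⟩
    A + (B + ∑≢ (shift f)) ≈⟨ +-congˡ (+-cong B≈A shifted≈0) ⟩
    A + (A + 0#)           ≈⟨ trans (+-congˡ (identityʳ A)) (z+z≈0 A) ⟩
    0#                     ∎
    where
    A B : Carrier
    A = ∑[ y < suc (suc m) ] f zero (suc y) (suc ∘ punchIn y)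
    B = ∑[ x < suc (suc m) ] f (suc x) zero (suc ∘ punchIn x)
    B≈A : B ≈ A
    B≈A = sum-cong-≋ λ x → f-sym (suc x) zero (suc ∘ punchIn x)
    shifted≈0 : ∑≢ (shift f) ≈ 0#
    shifted≈0 =
      ∑≢-symmetric z+z≈0 (shift f) (shift-extensional ext) (λ x y g → f-sym (suc x) (suc y) (lift 1 g))

  ∑∑-symmetric : (∀ z → z + z ≈ 0#) → ∀ {n} (f : Fin n → Fin n → Carrier) →
                 (∀ a b → f a b ≈ f b a) → ∑[ a < n ] ∑[ b < n ] f a b ≈ ∑[ a < n ] f a a
  ∑∑-symmetric z+z≈0 {zero}  f f-sym = refl
  ∑∑-symmetric z+z≈0 {suc n} f f-sym = begin
    (f zero zero + X) + ∑[ a < n ] (f (suc a) zero + ∑[ b < n ] f (suc a) (suc b))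
      ≈⟨ +-congˡ (∑-distrib-+ (λ a → f (suc a) zero) _) ⟩
    (f zero zero + X) + (∑[ a < n ] f (suc a) zero + ∑[ a < n ] ∑[ b < n ] f (suc a) (suc b))
      ≈⟨ +-congˡ (+-cong (sum-cong-≋ λ a → f-sym (suc a) zero) lower) ⟩
    (f zero zero + X) + (X + ∑[ a < n ] f (suc a) (suc a))
      ≈⟨ assoc _ _ _ ⟩
    f zero zero + (X + (X + ∑[ a < n ] f (suc a) (suc a)))
      ≈⟨ +-congˡ (trans (sym (assoc _ _ _)) (trans (+-congʳ (z+z≈0 X)) (identityˡ _))) ⟩
    f zero zero + ∑[ a < n ] f (suc a) (suc a) ∎
    where
    X : Carrier
    X = ∑[ b < n ] f zero (suc b)
    lower : ∑[ a < n ] ∑[ b < n ] f (suc a) (suc b) ≈ ∑[ a < n ] f (suc a) (suc a)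
    lower = ∑∑-symmetric z+z≈0 (λ a b → f (suc a) (suc b)) λ a b → f-sym (suc a) (suc b)

module Determinant (R : CommutativeRing 0ℓ 0ℓ) where

  open CommutativeRing R hiding (zero)
  open Det rawRing public
  open import Algebra.Properties.Semiring.Sum semiring
  open import Relation.Binary.Reasoning.Setoid setoid

  Matrix : ℕ → Set
  Matrix n = Fin n → Fin n → Carrier

  submatrix : ∀ {m n} → (Fin n → Fin m) → (Fin n → Fin m) → Matrix m → Matrix n
  submatrix r c M x y = M (r x) (c y)

  minor : ∀ {n} → Matrix (suc n) → Fin (suc n) → Fin (suc n) → Matrix n
  minor M i j = submatrix (punchIn i) (punchIn j) M

  _+ᴹ_ : ∀ {n} → Matrix n → Matrix n → Matrix n
  (M +ᴹ N) a b = M a b + N a b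

  ones : ∀ {n} → Matrix n
  ones a b = 1#

  idMatrix : ∀ {n} → Matrix n
  idMatrix a b = if δ a b then 1# else 0#

  record IsDerivation (d : Carrier → Carrier) : Set where
    field
      d-cong  : ∀ {x y} → x ≈ y → d x ≈ d y
      d-+     : ∀ x y → d (x + y) ≈ d x + d y
      leibniz : ∀ x y → d (x * y) ≈ d x * y + x * d y

  sumFin≡sum : ∀ {n} (f : Fin n → Carrier) → sumFin f ≡ sum f
  sumFin≡sum {zero}  f = ≡.refl
  sumFin≡sum {suc n} f = ≡.cong (f zero +_) (sumFin≡sum (f ∘ suc))

  det-cong : ∀ n {M N : Matrix n} → (∀ a b → M a b ≈ N a b) → det n M ≈ det n N
  det-cong zero    M≈N = refl
  det-cong (suc n) {M} {N} M≈N = begin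
    det (suc n) M ≡⟨ sumFin≡sum (term M) ⟩
    sum (term M)  ≈⟨ sum-cong-≋ term≈ ⟩
    sum (term N)  ≡⟨ sumFin≡sum (term N) ⟨
    det (suc n) N ∎
    where
    term : Matrix (suc n) → Fin (suc n) → Carrier
    term K j = sign j * K zero j * det n (minor K zero j)
    term≈ : ∀ j → term M j ≈ term N j
    term≈ j = *-cong (*-congˡ (M≈N zero j)) (det-cong n λ a b → M≈N (suc a) (punchIn j b))

  det-submatrix-congʳ : ∀ {m} n (r : Fin n → Fin m) {c c′ : Fin n → Fin m} (M : Matrix m) →
                        c ≗ c′ → det n (submatrix r c M) ≈ det n (submatrix r c′ M)
  det-submatrix-congʳ n r M c≗c′ = det-cong n λ x y → reflexive (≡.cong (M (r x)) (c≗c′ y))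

  ∑-idMatrix : ∀ {n} (a : Fin n) (g : Fin n → Carrier) → ∑[ b < n ] (idMatrix a b * g b) ≈ g a
  ∑-idMatrix {suc n} zero g = begin
    1# * g zero + ∑[ b < n ] (0# * g (suc b))
      ≈⟨ +-cong (*-identityˡ (g zero)) (sum-cong-≋ (zeroˡ ∘ g ∘ suc)) ⟩
    g zero + ∑[ b < n ] 0#                    ≈⟨ +-congˡ (sum-replicate-zero n) ⟩
    g zero + 0#                               ≈⟨ +-identityʳ (g zero) ⟩
    g zero                                    ∎
  ∑-idMatrix {suc n} (suc a) g = begin
    0# * g zero + ∑[ b < n ] (idMatrix (suc a) (suc b) * g (suc b))
      ≈⟨ +-cong (zeroˡ (g zero)) (sum-cong-≋ term≈) ⟩
    0# + ∑[ b < n ] (idMatrix a b * g (suc b)) ≈⟨ +-identityˡ _ ⟩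
    ∑[ b < n ] (idMatrix a b * g (suc b))      ≈⟨ ∑-idMatrix a (g ∘ suc) ⟩
    g (suc a)                                  ∎
    where
    term≈ : ∀ b → idMatrix (suc a) (suc b) * g (suc b) ≈ idMatrix a b * g (suc b)
    term≈ b = reflexive (≡.cong (λ t → (if t then 1# else 0#) * g (suc b)) (δ-suc a b))

  module CharacteristicTwo (x+x≈0 : ∀ x → x + x ≈ 0#) where

    open PairSums +-commutativeMonoid
    open import Algebra.Properties.Group +-group using (inverseʳ-unique)
    open import Algebra.Properties.CommutativeSemigroup *-commutativeSemigroup using (x∙yz≈y∙xz)
    open import Algebra.Properties.CommutativeSemigroup +-commutativeSemigroup using (interchange)

    sign≈1 : ∀ {n} (j : Fin n) → sign j ≈ 1#
    sign≈1 j with even (toℕ j)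
    ... | true  = refl
    ... | false = sym (inverseʳ-unique 1# 1# (x+x≈0 1#))

    det-expand : ∀ n (M : Matrix (suc n)) → det (suc n) M ≈ ∑[ j < suc n ] (M zero j * det n (minor M zero j))
    det-expand n M =
      trans (reflexive (sumFin≡sum λ j → sign j * M zero j * det n (minor M zero j))) (sum-cong-≋ unsigned)
      where
      unsigned : ∀ j → sign j * M zero j * det n (minor M zero j) ≈ M zero j * det n (minor M zero j)
      unsigned j = *-congʳ (trans (*-congʳ (sign≈1 j)) (*-identityˡ (M zero j)))

    det-expand-col : ∀ n (M : Matrix (suc n)) →
                     det (suc n) M ≈ ∑[ i < suc n ] (M i zero * det n (minor M i zero))
    det-expand-col zero    M = det-expand zero M
    det-expand-col (suc n) M = begin
      det (suc (suc n)) M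
        ≈⟨ det-expand (suc n) M ⟩
      M zero zero * D + ∑[ j < suc n ] (M zero (suc j) * det (suc n) (minor M zero (suc j)))
        ≈⟨ +-congˡ (sum-cong-≋ λ j → *-congˡ {M zero (suc j)} (det-expand-col n (minor M zero (suc j)))) ⟩
      M zero zero * D + ∑[ j < suc n ] (M zero (suc j) * ∑[ a < suc n ] (M (suc a) zero * Q a j))
        ≈⟨ +-congˡ (sum-cong-≋ λ j → *-distribˡ-sum (M zero (suc j)) (λ a → M (suc a) zero * Q a j)) ⟩
      M zero zero * D + ∑[ j < suc n ] ∑[ a < suc n ] (M zero (suc j) * (M (suc a) zero * Q a j))
        ≈⟨ +-congˡ (∑-comm λ j a → M zero (suc j) * (M (suc a) zero * Q a j)) ⟩
      M zero zero * D + ∑[ a < suc n ] ∑[ j < suc n ] (M zero (suc j) * (M (suc a) zero * Q a j))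
        ≈⟨ +-congˡ (sum-cong-≋ λ a → sum-cong-≋ (reorder a)) ⟩
      M zero zero * D + ∑[ a < suc n ] ∑[ j < suc n ] (M (suc a) zero * (M zero (suc j) * Q a j))
        ≈⟨ +-congˡ (sum-cong-≋ λ a → *-distribˡ-sum (M (suc a) zero) (λ j → M zero (suc j) * Q a j)) ⟨
      M zero zero * D + ∑[ a < suc n ] (M (suc a) zero * ∑[ j < suc n ] (M zero (suc j) * Q a j))
        ≈⟨ +-congˡ (sum-cong-≋ λ a → *-congˡ {M (suc a) zero} (det-expand n (minor M (suc a) zero))) ⟨
      M zero zero * D + ∑[ a < suc n ] (M (suc a) zero * det (suc n) (minor M (suc a) zero))
        ∎
      where
      D : Carrier
      D = det (suc n) (minor M zero zero)
      Q : Fin (suc n) → Fin (suc n) → Carrier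
      Q a j = det n (submatrix (suc ∘ punchIn a) (suc ∘ punchIn j) M)
      reorder : ∀ a j → M zero (suc j) * (M (suc a) zero * Q a j) ≈ M (suc a) zero * (M zero (suc j) * Q a j)
      reorder a j = x∙yz≈y∙xz (M zero (suc j)) (M (suc a) zero) (Q a j)

    det-transpose : ∀ n (M : Matrix n) → det n (λ a b → M b a) ≈ det n M
    det-transpose zero    M = refl
    det-transpose (suc n) M = begin
      det (suc n) (λ a b → M b a)
        ≈⟨ det-expand n (λ a b → M b a) ⟩
      ∑[ j < suc n ] (M j zero * det n (λ a b → M (punchIn j b) (suc a)))
        ≈⟨ sum-cong-≋ (λ j → *-congˡ {M j zero} (det-transpose n (minor M j zero))) ⟩
      ∑[ j < suc n ] (M j zero * det n (minor M j zero))
        ≈⟨ det-expand-col n M ⟨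
      det (suc n) M ∎

    -- Σ_{a,b} W_{ab} C_{ab}, C the cofactor matrix of M (no signs in characteristic two).
    minorSum : ∀ {n} → Matrix (suc n) → Matrix (suc n) → Carrier
    minorSum {n} W M = ∑[ a < suc n ] ∑[ b < suc n ] (W a b * det n (minor M a b))

    -- Both sides sum, over the ordered pairs (x, y) of distinct columns and the rows a,
    -- the product of M₀ₓ, W₍₁₊ₐ₎ᵧ and the minor deleting rows 0, 1 + a and columns x, y.
    minorSum-exchange : ∀ n (W M : Matrix (suc (suc n))) →
      ∑[ j < suc (suc n) ] (M zero j * minorSum (minor W zero j) (minor M zero j))
      ≈ ∑[ a < suc n ] ∑[ b < suc (suc n) ] (W (suc a) b * det (suc n) (minor M (suc a) b))
    minorSum-exchange n W M = begin
      ∑[ j < suc (suc n) ] (M zero j * minorSum (minor W zero j) (minor M zero j))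
        ≈⟨ sum-cong-≋ row₀-first ⟩
      ∑≢ h
        ≈⟨ ∑≢-swap h h-ext ⟩
      ∑≢ (λ x y → h y x)
        ≈⟨ sum-cong-≋ lower-first ⟩
      ∑[ b < suc (suc n) ] ∑[ a < suc n ] (W (suc a) b * det (suc n) (minor M (suc a) b))
        ≈⟨ ∑-comm (λ b a → W (suc a) b * det (suc n) (minor M (suc a) b)) ⟩
      ∑[ a < suc n ] ∑[ b < suc (suc n) ] (W (suc a) b * det (suc n) (minor M (suc a) b)) ∎
      where
      G : Fin (suc n) → (Fin n → Fin (suc (suc n))) → Carrier
      G a g = det n (submatrix (suc ∘ punchIn a) g M)
      h : PairFunction n
      h x y g = M zero x * ∑[ a < suc n ] (W (suc a) y * G a g)
      h-ext : Extensional h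
      h-ext x y g≗g′ = *-congˡ {M zero x} (sum-cong-≋ λ a →
        *-congˡ {W (suc a) y} (det-submatrix-congʳ n (suc ∘ punchIn a) M g≗g′))
      row₀-first : ∀ j → M zero j * minorSum (minor W zero j) (minor M zero j)
                       ≈ ∑[ b < suc n ] h j (punchIn j b) (punchIn j ∘ punchIn b)
      row₀-first j = begin
        M zero j * ∑[ a < suc n ] ∑[ b < suc n ] T a b
          ≈⟨ *-congˡ (∑-comm T) ⟩
        M zero j * ∑[ b < suc n ] ∑[ a < suc n ] T a b
          ≈⟨ *-distribˡ-sum (M zero j) (λ b → ∑[ a < suc n ] T a b) ⟩
        ∑[ b < suc n ] h j (punchIn j b) (punchIn j ∘ punchIn b) ∎
        where
        T : Fin (suc n) → Fin (suc n) → Carrier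
        T a b = W (suc a) (punchIn j b) * G a (punchIn j ∘ punchIn b)
      lower-first : ∀ b → ∑[ k < suc n ] h (punchIn b k) b (punchIn b ∘ punchIn k)
                        ≈ ∑[ a < suc n ] (W (suc a) b * det (suc n) (minor M (suc a) b))
      lower-first b = begin
        ∑[ k < suc n ] (M zero (punchIn b k) * ∑[ a < suc n ] (W (suc a) b * G′ a k))
          ≈⟨ sum-cong-≋ (λ k → *-distribˡ-sum (M zero (punchIn b k)) λ a → W (suc a) b * G′ a k) ⟩
        ∑[ k < suc n ] ∑[ a < suc n ] (M zero (punchIn b k) * (W (suc a) b * G′ a k))
          ≈⟨ sum-cong-≋ (λ k → sum-cong-≋ (reorder k)) ⟩
        ∑[ k < suc n ] ∑[ a < suc n ] (W (suc a) b * (M zero (punchIn b k) * G′ a k))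
          ≈⟨ ∑-comm (λ k a → W (suc a) b * (M zero (punchIn b k) * G′ a k)) ⟩
        ∑[ a < suc n ] ∑[ k < suc n ] (W (suc a) b * (M zero (punchIn b k) * G′ a k))
          ≈⟨ sum-cong-≋ (λ a → *-distribˡ-sum (W (suc a) b) λ k → M zero (punchIn b k) * G′ a k) ⟨
        ∑[ a < suc n ] (W (suc a) b * ∑[ k < suc n ] (M zero (punchIn b k) * G′ a k))
          ≈⟨ sum-cong-≋ (λ a → *-congˡ {W (suc a) b} (det-expand n (minor M (suc a) b))) ⟨
        ∑[ a < suc n ] (W (suc a) b * det (suc n) (minor M (suc a) b)) ∎
        where
        G′ : Fin (suc n) → Fin (suc n) → Carrier
        G′ a k = G a (punchIn b ∘ punchIn k)
        reorder : ∀ k a → M zero (punchIn b k) * (W (suc a) b * G′ a k)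
                        ≈ W (suc a) b * (M zero (punchIn b k) * G′ a k)
        reorder k a = x∙yz≈y∙xz (M zero (punchIn b k)) (W (suc a) b) (G′ a k)

    -- A minor deleting rows 0, 1 + a and columns x ≠ y occurs once for each order of x and y.
    ∑-minorSum-minors≈0 : ∀ n (M : Matrix (suc (suc n))) →
                          ∑[ j < suc (suc n) ] minorSum ones (minor M zero j) ≈ 0#
    ∑-minorSum-minors≈0 n M = begin
      ∑[ j < suc (suc n) ] ∑[ a < suc n ] ∑[ b < suc n ] G a (punchIn j ∘ punchIn b)
        ≈⟨ sum-cong-≋ (λ j → ∑-comm λ a b → G a (punchIn j ∘ punchIn b)) ⟩
      ∑≢ (λ _ _ g → ∑[ a < suc n ] G a g)
        ≈⟨ ∑≢-symmetric x+x≈0 (λ _ _ g → ∑[ a < suc n ] G a g) G-ext (λ _ _ _ → refl) ⟩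
      0# ∎
      where
      G : Fin (suc n) → (Fin n → Fin (suc (suc n))) → Carrier
      G a g = 1# * det n (submatrix (suc ∘ punchIn a) g M)
      G-ext : Extensional (λ _ _ g → ∑[ a < suc n ] G a g)
      G-ext _ _ g≗g′ = sum-cong-≋ λ a → *-congˡ {1#} (det-submatrix-congʳ n (suc ∘ punchIn a) M g≗g′)

    det-+ones : ∀ n (M : Matrix (suc n)) → det (suc n) (M +ᴹ ones) ≈ det (suc n) M + minorSum ones M
    det-+ones zero M = begin
      det 1 (M +ᴹ ones)                               ≈⟨ det-expand 0 (M +ᴹ ones) ⟩
      (M zero zero + 1#) * 1# + 0#                    ≈⟨ trans (+-identityʳ _) (*-identityʳ _) ⟩
      M zero zero + 1#                                ≈⟨ +-cong (trans (+-identityʳ _) (*-identityʳ _)) one≈ ⟨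
      (M zero zero * 1# + 0#) + ((1# * 1# + 0#) + 0#) ≈⟨ +-congʳ (det-expand 0 M) ⟨
      det 1 M + minorSum ones M                       ∎
      where
      one≈ : (1# * 1# + 0#) + 0# ≈ 1#
      one≈ = trans (+-identityʳ _) (trans (+-identityʳ _) (*-identityʳ 1#))
    det-+ones (suc n) M = begin
      det (suc (suc n)) (M +ᴹ ones)
        ≈⟨ det-expand (suc n) (M +ᴹ ones) ⟩
      ∑[ j < suc (suc n) ] ((M zero j + 1#) * det (suc n) (minor M zero j +ᴹ ones))
        ≈⟨ sum-cong-≋ (λ j → *-congˡ {M zero j + 1#} (det-+ones n (minor M zero j))) ⟩
      ∑[ j < suc (suc n) ] ((M zero j + 1#) * (P j + D j))
        ≈⟨ sum-cong-≋ (λ j → foil (M zero j) 1# (P j) (D j)) ⟩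
      ∑[ j < suc (suc n) ] ((M zero j * P j + 1# * P j) + (M zero j * D j + 1# * D j))
        ≈⟨ trans (∑-distrib-+ (λ j → M zero j * P j + 1# * P j) (λ j → M zero j * D j + 1# * D j))
                 (+-cong (∑-distrib-+ (λ j → M zero j * P j) (λ j → 1# * P j))
                         (∑-distrib-+ (λ j → M zero j * D j) (λ j → 1# * D j))) ⟩
      (∑[ j < suc (suc n) ] (M zero j * P j) + ∑[ j < suc (suc n) ] (1# * P j))
        + (∑[ j < suc (suc n) ] (M zero j * D j) + ∑[ j < suc (suc n) ] (1# * D j))
        ≈⟨ +-cong (+-congʳ (sym (det-expand (suc n) M))) (+-cong (minorSum-exchange n ones M) ∑D≈0) ⟩
      (det (suc (suc n)) M + ∑[ j < suc (suc n) ] (1# * P j)) + (lower + 0#)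
        ≈⟨ trans (+-congˡ (+-identityʳ lower)) (+-assoc _ _ _) ⟩
      det (suc (suc n)) M + minorSum ones M ∎
      where
      P D : Fin (suc (suc n)) → Carrier
      P j = det (suc n) (minor M zero j)
      D j = minorSum ones (minor M zero j)
      lower : Carrier
      lower = ∑[ a < suc n ] ∑[ b < suc (suc n) ] (1# * det (suc n) (minor M (suc a) b))
      foil : ∀ x y p q → (x + y) * (p + q) ≈ (x * p + y * p) + (x * q + y * q)
      foil x y p q =
        trans (distribʳ (p + q) x y) (trans (+-cong (distribˡ x p q) (distribˡ y p q)) (interchange _ _ _ _))
      ∑D≈0 : ∑[ j < suc (suc n) ] (1# * D j) ≈ 0#
      ∑D≈0 = trans (sum-cong-≋ (*-identityˡ ∘ D)) (∑-minorSum-minors≈0 n M)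

    minorSum-ones≈idMatrix : ∀ n (M : Matrix (suc n)) → (∀ a b → M a b ≈ M b a) →
                             minorSum ones M ≈ minorSum idMatrix M
    minorSum-ones≈idMatrix n M M-sym = begin
      minorSum ones M
        ≈⟨ ∑∑-symmetric x+x≈0 (λ a b → 1# * det n (minor M a b)) minors-sym ⟩
      ∑[ a < suc n ] (1# * det n (minor M a a))
        ≈⟨ sum-cong-≋ diagonal ⟩
      minorSum idMatrix M ∎
      where
      minors-sym : ∀ a b → 1# * det n (minor M a b) ≈ 1# * det n (minor M b a)
      minors-sym a b = *-congˡ {1#} (trans (sym (det-transpose n (minor M a b))) (det-cong n λ x y → M-sym _ _))
      diagonal : ∀ a → 1# * det n (minor M a a) ≈ ∑[ b < suc n ] (idMatrix a b * det n (minor M a b))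
      diagonal a = trans (*-identityˡ _) (sym (∑-idMatrix a λ b → det n (minor M a b)))

    module Jacobi {d : Carrier → Carrier} (isDerivation : IsDerivation d) where

      open IsDerivation isDerivation

      d-0≈0 : d 0# ≈ 0#
      d-0≈0 = trans (d-cong (sym (+-identityʳ 0#))) (trans (d-+ 0# 0#) (x+x≈0 (d 0#)))

      d-1≈0 : d 1# ≈ 0#
      d-1≈0 = trans (d-cong (sym (*-identityʳ 1#)))
                    (trans (leibniz 1# 1#) (trans (+-cong (*-identityʳ _) (*-identityˡ _)) (x+x≈0 (d 1#))))

      d-∑ : ∀ {n} (f : Fin n → Carrier) → d (sum f) ≈ ∑[ j < n ] d (f j)
      d-∑ {zero}  f = d-0≈0
      d-∑ {suc n} f = trans (d-+ (f zero) _) (+-congˡ (d-∑ (f ∘ suc)))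

      jacobi : ∀ n (N N′ : Matrix (suc n)) → (∀ a b → d (N a b) ≈ N′ a b) →
               d (det (suc n) N) ≈ minorSum N′ N
      jacobi-lower-rows : ∀ n (N N′ : Matrix (suc n)) → (∀ a b → d (N a b) ≈ N′ a b) →
                          ∑[ j < suc n ] (N zero j * d (det n (minor N zero j)))
                          ≈ ∑[ a < n ] ∑[ b < suc n ] (N′ (suc a) b * det n (minor N (suc a) b))

      jacobi n N N′ dN = begin
        d (det (suc n) N)                                     ≈⟨ d-cong (det-expand n N) ⟩
        d (∑[ j < suc n ] (N zero j * P j))                   ≈⟨ d-∑ (λ j → N zero j * P j) ⟩
        ∑[ j < suc n ] d (N zero j * P j)                     ≈⟨ sum-cong-≋ leibniz-row ⟩
        ∑[ j < suc n ] (N′ zero j * P j + N zero j * d (P j))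
          ≈⟨ ∑-distrib-+ (λ j → N′ zero j * P j) (λ j → N zero j * d (P j)) ⟩
        ∑[ j < suc n ] (N′ zero j * P j) + ∑[ j < suc n ] (N zero j * d (P j))
          ≈⟨ +-congˡ (jacobi-lower-rows n N N′ dN) ⟩
        minorSum N′ N ∎
        where
        P : Fin (suc n) → Carrier
        P j = det n (minor N zero j)
        leibniz-row : ∀ j → d (N zero j * P j) ≈ N′ zero j * P j + N zero j * d (P j)
        leibniz-row j = trans (leibniz (N zero j) (P j)) (+-congʳ (*-congʳ (dN zero j)))

      jacobi-lower-rows zero    N N′ dN = trans (+-identityʳ _) (trans (*-congˡ d-1≈0) (zeroʳ _))
      jacobi-lower-rows (suc n) N N′ dN = trans (sum-cong-≋ minor-jacobi) (minorSum-exchange n N′ N)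
        where
        minor-jacobi : ∀ j → N zero j * d (det (suc n) (minor N zero j))
                           ≈ N zero j * minorSum (minor N′ zero j) (minor N zero j)
        minor-jacobi j = *-congˡ (jacobi n (minor N zero j) (minor N′ zero j) λ a b → dN (suc a) (punchIn j b))

module PolynomialRing where

  open ≡ using (refl; cong; cong₂)

  coeff-+ₚ : ∀ p q k → coeff (p +ₚ q) k ≡ coeff p k xor coeff q k
  coeff-+ₚ []      q       k       = refl
  coeff-+ₚ (a ∷ p) []      k       = ≡.sym (xor-identityʳ _)
  coeff-+ₚ (a ∷ p) (b ∷ q) zero    = refl
  coeff-+ₚ (a ∷ p) (b ∷ q) (suc k) = coeff-+ₚ p q k

  +ₚ-assoc : ∀ p q r → (p +ₚ q) +ₚ r ≡ p +ₚ (q +ₚ r)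
  +ₚ-assoc []      q       r       = refl
  +ₚ-assoc (a ∷ p) []      r       = refl
  +ₚ-assoc (a ∷ p) (b ∷ q) []      = refl
  +ₚ-assoc (a ∷ p) (b ∷ q) (c ∷ r) = cong₂ _∷_ (xor-assoc a b c) (+ₚ-assoc p q r)

  +ₚ-comm : ∀ p q → p +ₚ q ≡ q +ₚ p
  +ₚ-comm []      []      = refl
  +ₚ-comm []      (b ∷ q) = refl
  +ₚ-comm (a ∷ p) []      = refl
  +ₚ-comm (a ∷ p) (b ∷ q) = cong₂ _∷_ (xor-comm a b) (+ₚ-comm p q)

  +ₚ-identityʳ : ∀ p → p +ₚ 0ₚ ≡ p
  +ₚ-identityʳ []      = refl
  +ₚ-identityʳ (a ∷ p) = refl

  +ₚ-commutativeMonoid : CommutativeMonoid 0ℓ 0ℓ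
  +ₚ-commutativeMonoid = record
    { Carrier = Poly ; _≈_ = _≡_ ; _∙_ = _+ₚ_ ; ε = 0ₚ
    ; isCommutativeMonoid = record
      { isMonoid = record
        { isSemigroup = record
          { isMagma = record { isEquivalence = ≡.isEquivalence ; ∙-cong = cong₂ _+ₚ_ }
          ; assoc = +ₚ-assoc }
        ; identity = (λ p → refl) , +ₚ-identityʳ }
      ; comm = +ₚ-comm } }

  open import Algebra.Properties.CommutativeSemigroup (CommutativeMonoid.commutativeSemigroup +ₚ-commutativeMonoid)
    using (interchange; x∙yz≈y∙xz)

  scaleₚ-distribˡ : ∀ c p q → scaleₚ c (p +ₚ q) ≡ scaleₚ c p +ₚ scaleₚ c q
  scaleₚ-distribˡ c []      q       = refl
  scaleₚ-distribˡ c (a ∷ p) []      = refl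
  scaleₚ-distribˡ c (a ∷ p) (b ∷ q) = cong₂ _∷_ (∧-distribˡ-xor c a b) (scaleₚ-distribˡ c p q)

  scaleₚ-distribʳ : ∀ a b r → scaleₚ (a xor b) r ≡ scaleₚ a r +ₚ scaleₚ b r
  scaleₚ-distribʳ a b []      = refl
  scaleₚ-distribʳ a b (c ∷ r) = cong₂ _∷_ (∧-distribʳ-xor c a b) (scaleₚ-distribʳ a b r)

  scaleₚ-assoc : ∀ a b p → scaleₚ a (scaleₚ b p) ≡ scaleₚ (a ∧ b) p
  scaleₚ-assoc a b []      = refl
  scaleₚ-assoc a b (c ∷ p) = cong₂ _∷_ (≡.sym (∧-assoc a b c)) (scaleₚ-assoc a b p)

  scaleₚ-true : ∀ p → scaleₚ true p ≡ p
  scaleₚ-true []      = refl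
  scaleₚ-true (a ∷ p) = cong (a ∷_) (scaleₚ-true p)

  *ₚ-distribʳ : ∀ p q r → (p +ₚ q) *ₚ r ≡ p *ₚ r +ₚ q *ₚ r
  *ₚ-distribʳ []      q       r = refl
  *ₚ-distribʳ (a ∷ p) []      r = ≡.sym (+ₚ-identityʳ _)
  *ₚ-distribʳ (a ∷ p) (b ∷ q) r =
    ≡.trans (cong₂ _+ₚ_ (scaleₚ-distribʳ a b r) (cong (false ∷_) (*ₚ-distribʳ p q r)))
            (interchange (scaleₚ a r) (scaleₚ b r) (false ∷ p *ₚ r) (false ∷ q *ₚ r))

  scaleₚ-*ₚ : ∀ a q r → scaleₚ a q *ₚ r ≡ scaleₚ a (q *ₚ r)
  scaleₚ-*ₚ a []      r = refl
  scaleₚ-*ₚ a (b ∷ q) r =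
    ≡.trans (cong₂ _+ₚ_ (≡.sym (scaleₚ-assoc a b r)) (cong₂ _∷_ (≡.sym (∧-zeroʳ a)) (scaleₚ-*ₚ a q r)))
            (≡.sym (scaleₚ-distribˡ a (scaleₚ b r) (false ∷ q *ₚ r)))

  -- `_≈ₚ_` unfolds to a Π-type, from which Agda cannot infer the compared polynomials;
  -- wrapped in a record it can.
  infix 4 _≋_
  record _≋_ (p q : Poly) : Set where
    constructor coeffwise
    field coeff-≡ : p ≈ₚ q
  open _≋_ public

  ≋-setoid : Setoid 0ℓ 0ℓ
  ≋-setoid = record
    { Carrier = Poly ; _≈_ = _≋_
    ; isEquivalence = record
      { refl  = coeffwise λ k → refl
      ; sym   = λ p≋q → coeffwise λ k → ≡.sym (coeff-≡ p≋q k)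
      ; trans = λ p≋q q≋r → coeffwise λ k → ≡.trans (coeff-≡ p≋q k) (coeff-≡ q≋r k) } }

  open Setoid ≋-setoid public
    using () renaming (refl to ≋-refl; sym to ≋-sym; trans to ≋-trans; reflexive to ≡⇒≋)
  open import Relation.Binary.Reasoning.Setoid ≋-setoid

  ∷-cong : ∀ {a b p q} → a ≡ b → p ≋ q → a ∷ p ≋ b ∷ q
  ∷-cong a≡b p≋q = coeffwise λ { zero → a≡b ; (suc k) → coeff-≡ p≋q k }

  false∷0ₚ≋0ₚ : false ∷ 0ₚ ≋ 0ₚ
  false∷0ₚ≋0ₚ = coeffwise λ { zero → refl ; (suc k) → refl }

  +ₚ-cong : ∀ {p p′ q q′} → p ≋ p′ → q ≋ q′ → p +ₚ q ≋ p′ +ₚ q′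
  +ₚ-cong {p} {p′} {q} {q′} p≋p′ q≋q′ = coeffwise λ k →
    ≡.trans (coeff-+ₚ p q k)
            (≡.trans (cong₂ _xor_ (coeff-≡ p≋p′ k) (coeff-≡ q≋q′ k)) (≡.sym (coeff-+ₚ p′ q′ k)))

  +ₚ-congˡ : ∀ p {q q′} → q ≋ q′ → p +ₚ q ≋ p +ₚ q′
  +ₚ-congˡ p = +ₚ-cong ≋-refl

  +ₚ-congʳ : ∀ {p p′} q → p ≋ p′ → p +ₚ q ≋ p′ +ₚ q
  +ₚ-congʳ q p≋p′ = +ₚ-cong p≋p′ ≋-refl

  +ₚ-self : ∀ p → p +ₚ p ≋ 0ₚ
  +ₚ-self []      = ≋-refl
  +ₚ-self (a ∷ p) = ≋-trans (∷-cong (xor-same a) (+ₚ-self p)) false∷0ₚ≋0ₚ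

  scaleₚ-false : ∀ p → scaleₚ false p ≋ 0ₚ
  scaleₚ-false []      = ≋-refl
  scaleₚ-false (a ∷ p) = ≋-trans (∷-cong refl (scaleₚ-false p)) false∷0ₚ≋0ₚ

  false∷-*ₚ : ∀ p q → (false ∷ p) *ₚ q ≋ false ∷ p *ₚ q
  false∷-*ₚ p q = +ₚ-congʳ (false ∷ p *ₚ q) (scaleₚ-false q)

  *ₚ-zeroˡ : ∀ p q → p ≋ 0ₚ → p *ₚ q ≋ 0ₚ
  *ₚ-zeroˡ []      q p≋0 = ≋-refl
  *ₚ-zeroˡ (a ∷ p) q p≋0 =
    ≋-trans (+ₚ-cong head≋0 (∷-cong refl (*ₚ-zeroˡ p q (coeffwise (coeff-≡ p≋0 ∘ suc))))) false∷0ₚ≋0ₚ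
    where
    head≋0 : scaleₚ a q ≋ 0ₚ
    head≋0 = ≋-trans (≡⇒≋ (cong (λ c → scaleₚ c q) (coeff-≡ p≋0 zero))) (scaleₚ-false q)

  *ₚ-zeroʳ : ∀ p → p *ₚ 0ₚ ≋ 0ₚ
  *ₚ-zeroʳ []      = ≋-refl
  *ₚ-zeroʳ (a ∷ p) = ≋-trans (∷-cong refl (*ₚ-zeroʳ p)) false∷0ₚ≋0ₚ

  -- p ≋ p′ gives p +ₚ p′ ≋ 0ₚ, to which *ₚ-zeroˡ applies.
  *ₚ-congʳ : ∀ {p p′} q → p ≋ p′ → p *ₚ q ≋ p′ *ₚ q
  *ₚ-congʳ {p} {p′} q p≋p′ = begin
    p *ₚ q                         ≡⟨ +ₚ-identityʳ (p *ₚ q) ⟨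
    p *ₚ q +ₚ 0ₚ                   ≈⟨ +ₚ-congˡ (p *ₚ q) (+ₚ-self (p′ *ₚ q)) ⟨
    p *ₚ q +ₚ (p′ *ₚ q +ₚ p′ *ₚ q) ≡⟨ +ₚ-assoc (p *ₚ q) (p′ *ₚ q) (p′ *ₚ q) ⟨
    (p *ₚ q +ₚ p′ *ₚ q) +ₚ p′ *ₚ q ≡⟨ cong (_+ₚ p′ *ₚ q) (*ₚ-distribʳ p p′ q) ⟨
    (p +ₚ p′) *ₚ q +ₚ p′ *ₚ q      ≈⟨ +ₚ-congʳ (p′ *ₚ q) (*ₚ-zeroˡ (p +ₚ p′) q p+p′≋0) ⟩
    p′ *ₚ q                        ∎
    where
    p+p′≋0 : p +ₚ p′ ≋ 0ₚ
    p+p′≋0 = ≋-trans (+ₚ-congʳ p′ p≋p′) (+ₚ-self p′)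

  *ₚ-∷ʳ : ∀ q a p → q *ₚ (a ∷ p) ≋ scaleₚ a q +ₚ (false ∷ q *ₚ p)
  *ₚ-∷ʳ []      a p = ≋-sym false∷0ₚ≋0ₚ
  *ₚ-∷ʳ (b ∷ q) a p = ∷-cong (cong (_xor false) (∧-comm b a)) (begin
    scaleₚ b p +ₚ q *ₚ (a ∷ p)                     ≈⟨ +ₚ-congˡ (scaleₚ b p) (*ₚ-∷ʳ q a p) ⟩
    scaleₚ b p +ₚ (scaleₚ a q +ₚ (false ∷ q *ₚ p)) ≡⟨ x∙yz≈y∙xz (scaleₚ b p) (scaleₚ a q) (false ∷ q *ₚ p) ⟩
    scaleₚ a q +ₚ (scaleₚ b p +ₚ (false ∷ q *ₚ p)) ∎)

  *ₚ-comm : ∀ p q → p *ₚ q ≋ q *ₚ p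
  *ₚ-comm []      q = ≋-sym (*ₚ-zeroʳ q)
  *ₚ-comm (a ∷ p) q = ≋-trans (+ₚ-congˡ (scaleₚ a q) (∷-cong refl (*ₚ-comm p q))) (≋-sym (*ₚ-∷ʳ q a p))

  *ₚ-congˡ : ∀ p {q q′} → q ≋ q′ → p *ₚ q ≋ p *ₚ q′
  *ₚ-congˡ p {q} {q′} q≋q′ = ≋-trans (*ₚ-comm p q) (≋-trans (*ₚ-congʳ p q≋q′) (*ₚ-comm q′ p))

  *ₚ-cong : ∀ {p p′ q q′} → p ≋ p′ → q ≋ q′ → p *ₚ q ≋ p′ *ₚ q′
  *ₚ-cong {p′ = p′} {q = q} p≋p′ q≋q′ = ≋-trans (*ₚ-congʳ q p≋p′) (*ₚ-congˡ p′ q≋q′)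

  *ₚ-assoc : ∀ p q r → (p *ₚ q) *ₚ r ≋ p *ₚ (q *ₚ r)
  *ₚ-assoc []      q r = ≋-refl
  *ₚ-assoc (a ∷ p) q r = begin
    (scaleₚ a q +ₚ (false ∷ p *ₚ q)) *ₚ r
      ≡⟨ *ₚ-distribʳ (scaleₚ a q) (false ∷ p *ₚ q) r ⟩
    scaleₚ a q *ₚ r +ₚ (false ∷ p *ₚ q) *ₚ r
      ≈⟨ +ₚ-cong (≡⇒≋ (scaleₚ-*ₚ a q r)) (false∷-*ₚ (p *ₚ q) r) ⟩
    scaleₚ a (q *ₚ r) +ₚ (false ∷ (p *ₚ q) *ₚ r)
      ≈⟨ +ₚ-congˡ (scaleₚ a (q *ₚ r)) (∷-cong refl (*ₚ-assoc p q r)) ⟩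
    scaleₚ a (q *ₚ r) +ₚ (false ∷ p *ₚ (q *ₚ r)) ∎

  *ₚ-identityˡ : ∀ p → 1ₚ *ₚ p ≋ p
  *ₚ-identityˡ p = ≋-trans (+ₚ-cong (≡⇒≋ (scaleₚ-true p)) false∷0ₚ≋0ₚ) (≡⇒≋ (+ₚ-identityʳ p))

  *ₚ-distribˡ : ∀ p q r → p *ₚ (q +ₚ r) ≋ p *ₚ q +ₚ p *ₚ r
  *ₚ-distribˡ p q r =
    ≋-trans (*ₚ-comm p (q +ₚ r)) (≋-trans (≡⇒≋ (*ₚ-distribʳ q r p)) (+ₚ-cong (*ₚ-comm q p) (*ₚ-comm r p)))

  F₂[x]-commutativeRing : CommutativeRing 0ℓ 0ℓ
  F₂[x]-commutativeRing = record
    { Carrier = Poly ; _≈_ = _≈ₚ_ ; _+_ = _+ₚ_ ; _*_ = _*ₚ_ ; -_ = -ₚ_ ; 0# = 0ₚ ; 1# = 1ₚ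
    ; isCommutativeRing = record
      { isRing = record
        { +-isAbelianGroup = record
          { isGroup = record
            { isMonoid = record
              { isSemigroup = record
                { isMagma = record
                  { isEquivalence = record
                    { refl = λ k → refl ; sym = λ e k → ≡.sym (e k) ; trans = λ e f k → ≡.trans (e k) (f k) }
                  ; ∙-cong = λ {p} {p′} {q} {q′} e f →
                      coeff-≡ (+ₚ-cong {p} {p′} {q} {q′} (coeffwise e) (coeffwise f)) }
                ; assoc = λ p q r → coeff-≡ (≡⇒≋ (+ₚ-assoc p q r)) }
              ; identity = (λ p k → refl) , (λ p → coeff-≡ (≡⇒≋ (+ₚ-identityʳ p))) }
            ; inverse = (λ p → coeff-≡ (+ₚ-self p)) , (λ p → coeff-≡ (+ₚ-self p))
            ; ⁻¹-cong = λ e → e }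
          ; comm = λ p q → coeff-≡ (≡⇒≋ (+ₚ-comm p q)) }
        ; *-cong = λ {p} {p′} {q} {q′} e f →
            coeff-≡ (*ₚ-cong {p} {p′} {q} {q′} (coeffwise e) (coeffwise f))
        ; *-assoc = λ p q r → coeff-≡ (*ₚ-assoc p q r)
        ; *-identity =
            (λ p → coeff-≡ (*ₚ-identityˡ p)) , (λ p → coeff-≡ (≋-trans (*ₚ-comm p 1ₚ) (*ₚ-identityˡ p)))
        ; distrib =
            (λ p q r → coeff-≡ (*ₚ-distribˡ p q r)) , (λ r p q → coeff-≡ (≡⇒≋ (*ₚ-distribʳ p q r))) }
      ; *-comm = λ p q → coeff-≡ (*ₚ-comm p q) } }

module FormalDerivative where

  open PolynomialRing
  open ≡ using (refl; cong; cong₂)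
  open import Data.Nat using (_+_)
  open import Data.Nat.Properties using (+-identityʳ; +-suc)
  open import Algebra.Properties.CommutativeSemigroup (CommutativeMonoid.commutativeSemigroup +ₚ-commutativeMonoid)
    using (x∙yz≈y∙xz)

  natMul-false : ∀ k → natMul k false ≡ false
  natMul-false k with even k
  ... | true  = refl
  ... | false = refl

  natMul-suc : ∀ k a → natMul (suc k) a ≡ a xor natMul k a
  natMul-suc k a with even k
  ... | true  = ≡.sym (xor-identityʳ a)
  ... | false = ≡.sym (xor-same a)

  natMul-xor : ∀ k a b → natMul k (a xor b) ≡ natMul k a xor natMul k b
  natMul-xor k a b with even k
  ... | true  = refl
  ... | false = refl

  natMul-∧ : ∀ k c a → natMul k (c ∧ a) ≡ c ∧ natMul k a
  natMul-∧ k c a with even k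
  ... | true  = ≡.sym (∧-zeroʳ c)
  ... | false = refl

  coeff-derivFrom : ∀ k p i → coeff (derivFrom k p) i ≡ natMul (k + i) (coeff p i)
  coeff-derivFrom k []      i       = ≡.sym (natMul-false (k + i))
  coeff-derivFrom k (a ∷ p) zero    = cong (λ m → natMul m a) (≡.sym (+-identityʳ k))
  coeff-derivFrom k (a ∷ p) (suc i) =
    ≡.trans (coeff-derivFrom (suc k) p i) (cong (λ m → natMul m (coeff p i)) (≡.sym (+-suc k i)))

  coeff-deriv : ∀ p i → coeff (deriv p) i ≡ natMul (suc i) (coeff p (suc i))
  coeff-deriv []      i = ≡.sym (natMul-false (suc i))
  coeff-deriv (a ∷ p) i = coeff-derivFrom 1 p i

  deriv-cong : ∀ {p q} → p ≋ q → deriv p ≋ deriv q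
  deriv-cong {p} {q} p≋q = coeffwise λ i →
    ≡.trans (coeff-deriv p i)
            (≡.trans (cong (natMul (suc i)) (coeff-≡ p≋q (suc i))) (≡.sym (coeff-deriv q i)))

  derivFrom-+ₚ : ∀ k p q → derivFrom k (p +ₚ q) ≡ derivFrom k p +ₚ derivFrom k q
  derivFrom-+ₚ k []      q       = refl
  derivFrom-+ₚ k (a ∷ p) []      = refl
  derivFrom-+ₚ k (a ∷ p) (b ∷ q) = cong₂ _∷_ (natMul-xor k a b) (derivFrom-+ₚ (suc k) p q)

  deriv-+ₚ : ∀ p q → deriv (p +ₚ q) ≡ deriv p +ₚ deriv q
  deriv-+ₚ []      q       = refl
  deriv-+ₚ (a ∷ p) []      = ≡.sym (+ₚ-identityʳ (deriv (a ∷ p)))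
  deriv-+ₚ (a ∷ p) (b ∷ q) = derivFrom-+ₚ 1 p q

  derivFrom-scaleₚ : ∀ k c p → derivFrom k (scaleₚ c p) ≡ scaleₚ c (derivFrom k p)
  derivFrom-scaleₚ k c []      = refl
  derivFrom-scaleₚ k c (a ∷ p) = cong₂ _∷_ (natMul-∧ k c a) (derivFrom-scaleₚ (suc k) c p)

  deriv-scaleₚ : ∀ c p → deriv (scaleₚ c p) ≡ scaleₚ c (deriv p)
  deriv-scaleₚ c []      = refl
  deriv-scaleₚ c (a ∷ p) = derivFrom-scaleₚ 1 c p

  derivFrom-suc : ∀ k p → derivFrom (suc k) p ≡ p +ₚ derivFrom k p
  derivFrom-suc k []      = refl
  derivFrom-suc k (a ∷ p) = cong₂ _∷_ (natMul-suc k a) (derivFrom-suc (suc k) p)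

  derivFrom-zero : ∀ p → derivFrom 0 p ≋ false ∷ deriv p
  derivFrom-zero []      = ≋-sym false∷0ₚ≋0ₚ
  derivFrom-zero (a ∷ p) = ≋-refl

  deriv-∷ : ∀ a p → deriv (a ∷ p) ≋ p +ₚ (false ∷ deriv p)
  deriv-∷ a p = ≋-trans (≡⇒≋ (derivFrom-suc 0 p)) (+ₚ-congˡ p (derivFrom-zero p))

  deriv-*ₚ : ∀ p q → deriv (p *ₚ q) ≋ deriv p *ₚ q +ₚ p *ₚ deriv q
  deriv-*ₚ []      q = ≋-refl
  deriv-*ₚ (a ∷ p) q = begin
    deriv (scaleₚ a q +ₚ (false ∷ p *ₚ q))
      ≡⟨ ≡.trans (deriv-+ₚ (scaleₚ a q) (false ∷ p *ₚ q))
                 (cong (_+ₚ deriv (false ∷ p *ₚ q)) (deriv-scaleₚ a q)) ⟩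
    S +ₚ deriv (false ∷ p *ₚ q)
      ≈⟨ +ₚ-congˡ S (deriv-∷ false (p *ₚ q)) ⟩
    S +ₚ (p *ₚ q +ₚ (false ∷ deriv (p *ₚ q)))
      ≈⟨ +ₚ-congˡ S (+ₚ-congˡ (p *ₚ q) (∷-cong refl (deriv-*ₚ p q))) ⟩
    S +ₚ (p *ₚ q +ₚ ((false ∷ deriv p *ₚ q) +ₚ (false ∷ p *ₚ deriv q)))
      ≡⟨ cong (S +ₚ_) (+ₚ-assoc (p *ₚ q) (false ∷ deriv p *ₚ q) (false ∷ p *ₚ deriv q)) ⟨
    S +ₚ ((p *ₚ q +ₚ (false ∷ deriv p *ₚ q)) +ₚ (false ∷ p *ₚ deriv q))
      ≡⟨ x∙yz≈y∙xz S (p *ₚ q +ₚ (false ∷ deriv p *ₚ q)) (false ∷ p *ₚ deriv q) ⟩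
    (p *ₚ q +ₚ (false ∷ deriv p *ₚ q)) +ₚ (a ∷ p) *ₚ deriv q
      ≈⟨ +ₚ-congʳ ((a ∷ p) *ₚ deriv q) (+ₚ-congˡ (p *ₚ q) (false∷-*ₚ (deriv p) q)) ⟨
    (p *ₚ q +ₚ (false ∷ deriv p) *ₚ q) +ₚ (a ∷ p) *ₚ deriv q
      ≡⟨ cong (_+ₚ (a ∷ p) *ₚ deriv q) (*ₚ-distribʳ p (false ∷ deriv p) q) ⟨
    (p +ₚ (false ∷ deriv p)) *ₚ q +ₚ (a ∷ p) *ₚ deriv q
      ≈⟨ +ₚ-congʳ ((a ∷ p) *ₚ deriv q) (*ₚ-congʳ q (deriv-∷ a p)) ⟨
    deriv (a ∷ p) *ₚ q +ₚ (a ∷ p) *ₚ deriv q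
      ∎
    where
    S : Poly
    S = scaleₚ a (deriv q)
    open import Relation.Binary.Reasoning.Setoid ≋-setoid

open PolynomialRing
open FormalDerivative
open Determinant F₂[x]-commutativeRing
  using (Matrix; det; det-cong; _+ᴹ_; ones; idMatrix; IsDerivation; module CharacteristicTwo)
open CharacteristicTwo (coeff-≡ ∘ +ₚ-self) using (det-+ones; minorSum; minorSum-ones≈idMatrix; module Jacobi)
open import Relation.Binary.Reasoning.Setoid ≋-setoid

deriv-isDerivation : IsDerivation deriv
deriv-isDerivation = record
  { d-cong  = λ {p} {q} p≈q → coeff-≡ (deriv-cong {p} {q} (coeffwise p≈q))
  ; d-+     = λ p q → coeff-≡ (≡⇒≋ (deriv-+ₚ p q))
  ; leibniz = λ p q → coeff-≡ (deriv-*ₚ p q) }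

open Jacobi deriv-isDerivation using (jacobi)

-- χ M is definitionally det (charMatrix M), since -ₚ is the identity.
charMatrix : ∀ {n} → Mat n → Matrix n
charMatrix M i j = scaleₚ (δ i j) Xₚ +ₚ constₚ (M i j)

-- constₚ (a xor true) computes to constₚ a +ₚ 1ₚ.
χ-+J : ∀ {n} (M : Mat n) → χ (M +ₘ J) ≈ₚ det n (charMatrix M +ᴹ ones)
χ-+J {n} M = det-cong n {charMatrix (M +ₘ J)} {charMatrix M +ᴹ ones} λ i j →
  coeff-≡ (≡⇒≋ (≡.sym (+ₚ-assoc (scaleₚ (δ i j) Xₚ) (constₚ (M i j)) 1ₚ)))

deriv-charMatrix : ∀ {n} (M : Mat n) i j → deriv (charMatrix M i j) ≈ₚ idMatrix i j
deriv-charMatrix M i j with δ i j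
... | true  = λ k → ≡.refl
... | false = coeff-≡ false∷0ₚ≋0ₚ

lemma4p2 : (n : ℕ) (A : Mat n) → IsSimpleGraphAdj A →
    χ (A +ₘ J) ≈ₚ (χ A +ₚ deriv (χ A))
lemma4p2 zero    A _           = λ k → ≡.refl
lemma4p2 (suc n) A (A-sym , _) = coeff-≡ (begin
  χ (A +ₘ J)                 ≈⟨ coeffwise (χ-+J A) ⟩
  det (suc n) (N +ᴹ ones)    ≈⟨ coeffwise (det-+ones n N) ⟩
  χ A +ₚ minorSum ones N     ≈⟨ +ₚ-congˡ (χ A) (coeffwise (minorSum-ones≈idMatrix n N N-sym)) ⟩
  χ A +ₚ minorSum idMatrix N ≈⟨ +ₚ-congˡ (χ A) (coeffwise (jacobi n N idMatrix (deriv-charMatrix A))) ⟨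
  χ A +ₚ deriv (χ A)         ∎)
  where
  N : Matrix (suc n)
  N = charMatrix A
  N-sym : ∀ a b → N a b ≈ₚ N b a
  N-sym a b = coeff-≡ (≡⇒≋ (≡.cong₂ (λ d c → scaleₚ d Xₚ +ₚ constₚ c) (δ-sym a b) (A-sym a b)))
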